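{- Let $r\le s\le t$ be positive integers with $r>1$ and $t<2s$. Then \[ N(r,s,t)\le\frac{s^2-s}{2s-t}. \]
   Context: For positive integers $r\le s\le t$, a latin rectangle of type $(r,s,t)$ is an $r\times s$ array whose cells are filled with symbols from a set of $t$ symbols such that no symbol occurs more than once in any row or any column. Two such rectangles are orthogonal if, when superimposed, the $rs$ ordered pairs of symbols in corresponding cells are all distinct. $N(r,s,t)$ denotes the maximum size of a set of pairwise orthogonal latin rectangles of type $(r,s,t)$. -}

module Defs where

open import Data.Nat using (ℕ)
open import Data.Fin using (Fin)
open import Data.Product using (Σ; _×_; _,_)
open import Relation.Binary.PropositionalEquality using (_≡_; _≢_)

record LatinRectangle (r s t : ℕ) : Set where
  field
    cell   : Fin r → Fin s → Fin t
    rowInj : ∀ i {j j′} → cell i j ≡ cell i j′ → j ≡ j′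
    colInj : ∀ j {i i′} → cell i j ≡ cell i′ j → i ≡ i′
open LatinRectangle public

Orthogonal : ∀ {r s t} → LatinRectangle r s t → LatinRectangle r s t → Set
Orthogonal {r} {s} L M =
  ∀ (i i′ : Fin r) (j j′ : Fin s) →
    (cell L i j , cell M i j) ≡ (cell L i′ j′ , cell M i′ j′) →
    (i ≡ i′) × (j ≡ j′)

MOLR : (k r s t : ℕ) → Set
MOLR k r s t =
  Σ (Fin k → LatinRectangle r s t)
    (λ L → ∀ (a b : Fin k) → a ≢ b → Orthogonal (L a) (L b))

module Submission where

-- In a latin rectangle L with at least two rows, call a pair of columns
-- (j , j′) a link of L when the symbol in row 1, column j reappears in
-- row 0, column j′.  The argument has three steps.
--  * Rows 0 and 1 are injections Fin s → Fin t, and two injections into a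
--    t-set have at least 2s − t coincidences; so every L has ≥ 2s − t links.
--  * A link (j , j′) always has j ≢ j′ (columns are injective), and two
--    orthogonal rectangles share no link (a common link would give equal
--    pairs of symbols at the cells (1 , j) and (0 , j′)).
--  * Hence the links of k pairwise orthogonal rectangles, together with the s
--    diagonal pairs (j , j), form a duplicate-free list of column pairs, so
--    k (2s − t) + s ≤ s².

open import Defs
open import Data.Nat using (ℕ; zero; suc; _+_; _*_; _∸_; _≤_; _<_; z≤n; s≤s)
open import Data.Nat.Properties
  using (≤-trans; +-mono-≤; +-monoˡ-≤; +-monoʳ-≤; +-identityʳ; +-assoc;
         m≤n+o⇒m∸n≤o; m+n≤o⇒m≤o∸n; module ≤-Reasoning)
open import Data.Fin using (Fin; _≟_) renaming (zero to fzero; suc to fsuc)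
open import Data.Fin.Properties using (any?)
open import Data.List using (List; []; _∷_; _++_; map; length; concat; tabulate; filter; allFin; cartesianProduct)
open import Data.List.Properties using (length-++; length-++-sucʳ; length-map; length-tabulate)
open import Data.List.Membership.Propositional using (_∈_; _∉_)
open import Data.List.Membership.Propositional.Properties
  using (∈-∃++; ∈-++⁻; ∈-++⁺ˡ; ∈-++⁺ʳ; ∈-map⁺; ∈-map⁻; ∈-allFin; ∈-filter⁺; ∈-filter⁻;
         ∈-cartesianProduct⁺; ∈-concat⁻)
open import Data.List.Relation.Binary.Subset.Propositional using (_⊆_)
open import Data.List.Relation.Binary.Disjoint.Propositional using (Disjoint)
open import Data.List.Relation.Unary.Any using (here; there)
open import Data.List.Relation.Unary.Any.Properties using () renaming (tabulate⁻ to Any-tabulate⁻)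
open import Data.List.Relation.Unary.All as All using ()
open import Data.List.Relation.Unary.All.Properties using () renaming (tabulate⁺ to All-tabulate⁺)
open import Data.List.Relation.Unary.AllPairs using (_∷_)
open import Data.List.Relation.Unary.AllPairs.Properties using () renaming (tabulate⁺ to AllPairs-tabulate⁺)
open import Data.List.Relation.Unary.Unique.Propositional using (Unique)
open import Data.List.Relation.Unary.Unique.Propositional.Properties
  using (map⁺; ++⁺; concat⁺; filter⁺; cartesianProduct⁺; allFin⁺)
open import Data.Product using (_×_; _,_; proj₁; proj₂; ∃)
open import Data.Sum using (inj₁; inj₂)
open import Relation.Nullary using (¬_; yes; no; ¬?; contradiction)
open import Function using (id)
open import Relation.Unary using (Decidable)
open import Function.Definitions using (Injective)
open import Relation.Binary.PropositionalEquality using (_≡_; _≢_; refl; sym; trans; cong; cong₂; ≢-sym)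

private
  variable
    A B : Set

∈-delete : {x y : A} (as : List A) {bs : List A} → y ∈ as ++ x ∷ bs → y ≢ x → y ∈ as ++ bs
∈-delete as y∈ y≢x with ∈-++⁻ as y∈
... | inj₁ y∈as         = ∈-++⁺ˡ y∈as
... | inj₂ (here y≡x)   = contradiction y≡x y≢x
... | inj₂ (there y∈bs) = ∈-++⁺ʳ as y∈bs

unique-⊆⇒length≤ : {xs ys : List A} → Unique xs → xs ⊆ ys → length xs ≤ length ys
unique-⊆⇒length≤ {xs = []} _ _ = z≤n
unique-⊆⇒length≤ {xs = x ∷ xs} (x≢xs ∷ unique-xs) xs⊆ys
  with as , bs , refl ← ∈-∃++ (xs⊆ys (here refl)) = begin
    suc (length xs)          ≤⟨ s≤s (unique-⊆⇒length≤ unique-xs tail⊆) ⟩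
    suc (length (as ++ bs))  ≡⟨ length-++-sucʳ as x bs ⟨
    length (as ++ x ∷ bs)    ∎
  where
  open ≤-Reasoning
  tail⊆ : xs ⊆ as ++ bs
  tail⊆ y∈xs = ∈-delete as (xs⊆ys (there y∈xs)) (≢-sym (All.lookup x≢xs y∈xs))

length-cartesianProduct : (xs : List A) (ys : List B) →
                          length (cartesianProduct xs ys) ≡ length xs * length ys
length-cartesianProduct []       ys = refl
length-cartesianProduct (x ∷ xs) ys = trans (length-++ (map (x ,_) ys))
  (cong₂ _+_ (length-map (x ,_) ys) (length-cartesianProduct xs ys))

length-concat-tabulate : ∀ k (F : Fin k → List A) {m} → (∀ a → m ≤ length (F a)) →
                         k * m ≤ length (concat (tabulate F))
length-concat-tabulate zero    F long = z≤n
length-concat-tabulate {A} (suc k) F {m} long = begin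
  m + k * m                                          ≤⟨ +-mono-≤ (long fzero) rest ⟩
  length (F fzero) + length (concat (tabulate F′))   ≡⟨ length-++ (F fzero) ⟨
  length (concat (tabulate F))                       ∎
  where
  open ≤-Reasoning
  F′ : Fin k → List A
  F′ a = F (fsuc a)
  rest : k * m ≤ length (concat (tabulate F′))
  rest = length-concat-tabulate k F′ (λ a → long (fsuc a))

length-allFin : ∀ n → length (allFin n) ≡ n
length-allFin n = length-tabulate {n = n} id

allPairs : ∀ s → List (Fin s × Fin s)
allPairs s = cartesianProduct (allFin s) (allFin s)

∈-allPairs : ∀ {s} (p : Fin s × Fin s) → p ∈ allPairs s
∈-allPairs (i , j) = ∈-cartesianProduct⁺ (∈-allFin i) (∈-allFin j)

unique-allPairs : ∀ s → Unique (allPairs s)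
unique-allPairs s = cartesianProduct⁺ (allFin⁺ s) (allFin⁺ s)

length-allPairs : ∀ s → length (allPairs s) ≡ s * s
length-allPairs s = trans (length-cartesianProduct (allFin s) (allFin s))
                          (cong₂ _*_ (length-allFin s) (length-allFin s))

-- When f and g are injective there are at least 2s − t of them,
-- because the values of f together with the values of g that f misses are
-- distinct elements of Fin t.
module Coincidences {s t : ℕ} (f g : Fin s → Fin t) where

  Coincident : Fin s × Fin s → Set
  Coincident (j , j′) = g j ≡ f j′

  coincident? : Decidable Coincident
  coincident? (j , j′) = g j ≟ f j′

  coincidences : List (Fin s × Fin s)
  coincidences = filter coincident? (allPairs s)

  ∈-coincidences⁻ : ∀ {j j′} → (j , j′) ∈ coincidences → g j ≡ f j′
  ∈-coincidences⁻ j,j′∈ = proj₂ (∈-filter⁻ coincident? {xs = allPairs s} j,j′∈)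

  unique-coincidences : Unique coincidences
  unique-coincidences = filter⁺ coincident? (unique-allPairs s)

  Missed : Fin s → Set
  Missed j = ¬ (∃ λ j′ → f j′ ≡ g j)

  missed? : Decidable Missed
  missed? j = ¬? (any? (λ j′ → f j′ ≟ g j))

  missed : List (Fin s)
  missed = filter missed? (allFin s)

  -- Each point is missed or is the first component of a coincidence.
  s≤missed+coincidences : s ≤ length missed + length coincidences
  s≤missed+coincidences = begin
    s                                                ≡⟨ length-allFin s ⟨
    length (allFin s)                                ≤⟨ unique-⊆⇒length≤ (allFin⁺ s) covered ⟩
    length (missed ++ map proj₁ coincidences)        ≡⟨ length-++ missed ⟩
    length missed + length (map proj₁ coincidences)  ≡⟨ cong (length missed +_) (length-map proj₁ coincidences) ⟩
    length missed + length coincidences              ∎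
    where
    open ≤-Reasoning
    covered : allFin s ⊆ missed ++ map proj₁ coincidences
    covered {j} _ with any? (λ j′ → f j′ ≟ g j)
    ... | yes (j′ , fj′≡gj) =
      ∈-++⁺ʳ missed (∈-map⁺ proj₁ (∈-filter⁺ coincident? (∈-allPairs (j , j′)) (sym fj′≡gj)))
    ... | no no-preimage = ∈-++⁺ˡ (∈-filter⁺ missed? (∈-allFin j) no-preimage)

  module _ (f-inj : Injective _≡_ _≡_ f) (g-inj : Injective _≡_ _≡_ g) where

    -- The values of f and the values of g on missed points are distinct.
    s+missed≤t : s + length missed ≤ t
    s+missed≤t = begin
      s + length missed                                  ≡⟨ cong₂ _+_ lengthˡ lengthʳ ⟨
      length (map f (allFin s)) + length (map g missed)  ≡⟨ length-++ (map f (allFin s)) ⟨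
      length (map f (allFin s) ++ map g missed)          ≤⟨ unique-⊆⇒length≤ distinct (λ {v} _ → ∈-allFin v) ⟩
      length (allFin t)                                  ≡⟨ length-allFin t ⟩
      t                                                  ∎
      where
      open ≤-Reasoning
      lengthˡ : length (map f (allFin s)) ≡ s
      lengthˡ = trans (length-map f (allFin s)) (length-allFin s)
      lengthʳ : length (map g missed) ≡ length missed
      lengthʳ = length-map g missed
      separate : Disjoint (map f (allFin s)) (map g missed)
      separate (v∈f , v∈g) with ∈-map⁻ f v∈f | ∈-map⁻ g v∈g
      ... | j′ , _ , v≡fj′ | j , j-missed , v≡gj =
        proj₂ (∈-filter⁻ missed? {xs = allFin s} j-missed) (j′ , trans (sym v≡fj′) v≡gj)
      distinct : Unique (map f (allFin s) ++ map g missed)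
      distinct = ++⁺ (map⁺ f-inj (allFin⁺ s)) (map⁺ g-inj (filter⁺ missed? (allFin⁺ s))) separate

    coincidences-lower : 2 * s ∸ t ≤ length coincidences
    coincidences-lower = m≤n+o⇒m∸n≤o (2 * s) t (begin
      2 * s                                      ≡⟨ cong (s +_) (+-identityʳ s) ⟩
      s + s                                      ≤⟨ +-monoʳ-≤ s s≤missed+coincidences ⟩
      s + (length missed + length coincidences)  ≡⟨ +-assoc s (length missed) _ ⟨
      s + length missed + length coincidences    ≤⟨ +-monoˡ-≤ (length coincidences) s+missed≤t ⟩
      t + length coincidences                    ∎)
      where open ≤-Reasoning

row₀ row₁ : ∀ {r} → Fin (suc (suc r))
row₀ = fzero
row₁ = fsuc fzero

module _ {r s t : ℕ} where

  links : LatinRectangle (suc (suc r)) s t → List (Fin s × Fin s)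
  links L = Coincidences.coincidences (cell L row₀) (cell L row₁)

  ∈-links⁻ : ∀ L {j j′} → (j , j′) ∈ links L → cell L row₁ j ≡ cell L row₀ j′
  ∈-links⁻ L = Coincidences.∈-coincidences⁻ (cell L row₀) (cell L row₁)

  unique-links : ∀ L → Unique (links L)
  unique-links L = Coincidences.unique-coincidences (cell L row₀) (cell L row₁)

  links-lower : ∀ L → 2 * s ∸ t ≤ length (links L)
  links-lower L = Coincidences.coincidences-lower (cell L row₀) (cell L row₁)
                    (rowInj L row₀) (rowInj L row₁)

  link-offDiagonal : ∀ L j → (j , j) ∉ links L
  link-offDiagonal L j jj∈links with colInj L j (∈-links⁻ L jj∈links)
  ... | ()

  -- A common link (j , j′) of L and M would make the cells (1 , j) and
  -- (0 , j′) carry the same pair of symbols.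
  orthogonal⇒disjoint-links : ∀ {L M} → Orthogonal L M → Disjoint (links L) (links M)
  orthogonal⇒disjoint-links {L} {M} L⊥M {j , j′} (∈L , ∈M)
    with L⊥M row₁ row₀ j j′ (cong₂ _,_ (∈-links⁻ L ∈L) (∈-links⁻ M ∈M))
  ... | () , _

orthogonal-family-bound : ∀ {k r s t} (L : Fin k → LatinRectangle (suc (suc r)) s t) →
                          (∀ a b → a ≢ b → Orthogonal (L a) (L b)) →
                          k * (2 * s ∸ t) ≤ s * s ∸ s
orthogonal-family-bound {k} {s = s} {t} L orthogonal =
  ≤-trans many-links (m+n≤o⇒m≤o∸n (length allLinks) few-links)
  where
  allLinks : List (Fin s × Fin s)
  allLinks = concat (tabulate (λ a → links (L a)))

  diagonal : List (Fin s × Fin s)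
  diagonal = map (λ j → j , j) (allFin s)

  many-links : k * (2 * s ∸ t) ≤ length allLinks
  many-links = length-concat-tabulate k (λ a → links (L a)) (λ a → links-lower (L a))

  unique-allLinks : Unique allLinks
  unique-allLinks = concat⁺ (All-tabulate⁺ (λ a → unique-links (L a)))
    (AllPairs-tabulate⁺ (λ {a b} a≢b → orthogonal⇒disjoint-links {L = L a} {M = L b} (orthogonal a b a≢b)))

  off-diagonal : Disjoint allLinks diagonal
  off-diagonal (p∈links , p∈diagonal) with ∈-map⁻ (λ j → j , j) p∈diagonal
  ... | j , _ , refl with Any-tabulate⁻ (∈-concat⁻ (tabulate (λ a → links (L a))) p∈links)
  ... | a , jj∈links = link-offDiagonal (L a) j jj∈links

  few-links : length allLinks + s ≤ s * s
  few-links = begin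
    length allLinks + s                ≡⟨ cong (length allLinks +_) length-diagonal ⟨
    length allLinks + length diagonal  ≡⟨ length-++ allLinks ⟨
    length (allLinks ++ diagonal)      ≤⟨ unique-⊆⇒length≤ distinct (λ {p} _ → ∈-allPairs p) ⟩
    length (allPairs s)                ≡⟨ length-allPairs s ⟩
    s * s                              ∎
    where
    open ≤-Reasoning
    length-diagonal : length diagonal ≡ s
    length-diagonal = trans (length-map (λ j → j , j) (allFin s)) (length-allFin s)
    distinct : Unique (allLinks ++ diagonal)
    distinct = ++⁺ unique-allLinks (map⁺ {f = λ j → j , j} (cong proj₁) (allFin⁺ s)) off-diagonal

-- Corollary 2.5.
corollary2p5 : (r s t k : ℕ) → 1 < r → r ≤ s → s ≤ t → t < 2 * s →
               MOLR k r s t → k * (2 * s ∸ t) ≤ s * s ∸ s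
corollary2p5 (suc zero) s t k (s≤s ()) _ _ _ _
corollary2p5 (suc (suc r)) s t k _ _ _ _ (L , orthogonal) = orthogonal-family-bound L orthogonal
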